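{- Let $n$ be a positive integer, let $\lambda=(\lambda_1\ge\cdots\ge\lambda_n)$ be a partition with exactly $n$ parts, $\lambda_1=n$, and $\lambda_i\ge n+1-i$ for all $i$, and let $\pi$ be uniformly distributed on $\operatorname{RP}(\lambda)$. Let $t\le\operatorname{mr}(\lambda)$ be a positive integer. Then for any $t$ distinct boxes $b_1=(i_1,j_1),\ldots,b_t=(i_t,j_t)\in[n]^2$, \[ \mathbb{E}\!\left( \pi_{b_1} \pi_{b_2} \cdots \pi_{b_t} \right) \le \frac{1}{\operatorname{mr}(\lambda) (\operatorname{mr}(\lambda) - 1) \cdots (\operatorname{mr}(\lambda) - t + 1)}. \]
   Context: $\operatorname{RP}(\lambda)$ is the set of $n\times n$ permutation matrices $\pi=(\pi_{ij})$ with $\pi_{ij}=0$ whenever $j>\lambda_{n+1-i}$; for a box $b=(i,j)$, $\pi_b:=\pi_{ij}$. View $\lambda$ as a lattice path from $(0,n)$ to $(n,0)$ (the boundary of its Young diagram in French notation, the $i$-th row from the bottom having length $\lambda_i$), and write it as $R^{r_1}D^{d_1}R^{r_2}D^{d_2}\cdots R^{r_s}D^{d_s}$ with all exponents positive, where $R$ is a unit step right and $D$ a unit step down. Explicitly, if the distinct part values are $v_1<v_2<\cdots<v_s$ with multiplicities $d_1,\ldots,d_s$, then $r_1=v_1$ and $r_\ell=v_\ell-v_{\ell-1}$ for $\ell\ge2$. The minimum run is $\operatorname{mr}(\lambda):=\min\{r_1,d_1,\ldots,r_s,d_s\}$. -}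

module Defs where

open import Data.Nat using (ℕ; zero; suc; _∸_; _<_; _≤_; _⊓_; _≡ᵇ_)
open import Data.Nat.Properties using (_<?_)
open import Data.Bool using (if_then_else_)
open import Data.Fin using (Fin; toℕ; opposite; _≟_)
open import Data.Fin.Properties using (all?)
open import Data.Product using (_×_; _,_)
open import Data.List using (List; []; _∷_; map; concatMap; allFin; foldr; reverse; filter; length)
open import Data.Vec using (Vec; lookup; toList) renaming ([] to []ᵥ; _∷_ to _∷ᵥ_)
open import Relation.Nullary using (Dec; ¬_)
open import Relation.Nullary.Decidable using (_→-dec_; ¬?)
open import Relation.Binary.PropositionalEquality using (_≡_)

-- A partition λ = (λ₁ ≥ … ≥ λₙ) is a  Vec ℕ n  with  lookup λ k = λ_{k+1}.
-- An n×n permutation matrix π is encoded by the map σ : Fin n → Fin n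
-- (a Vec (Fin n) n) with  π_{ij} = 1  iff  σ(i) = j  (rows/columns 0-indexed).

allVecs : (m k : ℕ) → List (Vec (Fin m) k)
allVecs m zero    = []ᵥ ∷ []
allVecs m (suc k) = concatMap (λ x → map (x ∷ᵥ_) (allVecs m k)) (allFin m)

IsPerm : ∀ {n} → Vec (Fin n) n → Set
IsPerm {n} σ = (i j : Fin n) → lookup σ i ≡ lookup σ j → i ≡ j

-- Membership in RP(λ): π_{ij} = 0 whenever j > λ_{n+1-i} (1-indexed).
-- 0-indexed: the entry in row i is in column σ(i) with σ(i)+1 ≤ λ_{n-i},
-- and λ_{n-i} (1-indexed) = lookup λ (opposite i).
InRP : ∀ {n} → Vec ℕ n → Vec (Fin n) n → Set
InRP {n} lam σ = IsPerm σ × ((i : Fin n) → toℕ (lookup σ i) < lookup lam (opposite i))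

isPerm? : ∀ {n} (σ : Vec (Fin n) n) → Dec (IsPerm σ)
isPerm? σ = all? λ i → all? λ j → (lookup σ i ≟ lookup σ j) →-dec (i ≟ j)

inRP? : ∀ {n} (lam : Vec ℕ n) (σ : Vec (Fin n) n) → Dec (InRP lam σ)
inRP? lam σ = isPerm? σ Relation.Nullary.Decidable.×-dec all? (λ i → toℕ (lookup σ i) <? lookup lam (opposite i))

countRP : ∀ {n} → Vec ℕ n → ℕ
countRP {n} lam = length (filter (inRP? lam) (allVecs n n))

Hits : ∀ {n} → Vec (Fin n) n → Fin n × Fin n → Set
Hits σ (i , j) = lookup σ i ≡ j

hits? : ∀ {n} (σ : Vec (Fin n) n) (b : Fin n × Fin n) → Dec (Hits σ b)
hits? σ (i , j) = lookup σ i ≟ j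

-- #{ π ∈ RP(λ) : π_{b_1} = … = π_{b_t} = 1 }, so that
-- E(π_{b_1} ⋯ π_{b_t}) = countHits λ b / countRP λ for uniform π on RP(λ).
countHits : ∀ {n t} → Vec ℕ n → (Fin t → Fin n × Fin n) → ℕ
countHits {n} lam b =
  length (filter (λ σ → inRP? lam σ Relation.Nullary.Decidable.×-dec all? (λ k → hits? σ (b k))) (allVecs n n))

groupRuns : List ℕ → List (ℕ × ℕ)
groupRuns [] = []
groupRuns (x ∷ xs) with groupRuns xs
... | [] = (x , 1) ∷ []
... | (y , m) ∷ rest = if x ≡ᵇ y then (y , suc m) ∷ rest else (x , 1) ∷ (y , m) ∷ rest

-- From increasing (value , multiplicity) pairs (v_ℓ , d_ℓ), list r_1, d_1, r_2, d_2, …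
-- where r_ℓ = v_ℓ - v_{ℓ-1} (v_0 = 0).
runLengths : ℕ → List (ℕ × ℕ) → List ℕ
runLengths prev [] = []
runLengths prev ((v , d) ∷ rest) = (v ∸ prev) ∷ d ∷ runLengths v rest

minList : List ℕ → ℕ
minList [] = 0
minList (x ∷ xs) = foldr _⊓_ x xs

-- mr(λ) = min{r_1, d_1, …, r_s, d_s}; parts listed in increasing order λ_n ≤ … ≤ λ_1.
mr : ∀ {n} → Vec ℕ n → ℕ
mr lam = minList (runLengths 0 (groupRuns (reverse (toList lam))))

{-# OPTIONS --safe #-}
module Submission where

-- Induction on t, removing the first box (i, j) at each step. Let a r be the part of λ bounding
-- row r. Given σ ∈ RP(λ) hitting all boxes, swap row i with a row r such that a i > σ r and
-- a r > j = σ i, and such that r carries none of the other boxes: the result lies in RP(λ), hits the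
-- other boxes, and determines σ and r. At least mr(λ) rows are swappable: a non-swappable row either
-- has σ r ≥ a i (at most n − a i rows, σ being injective) or has a r ≤ j < a i; distinct parts of λ
-- differ by at least mr(λ), so then a r ≤ a i − mr(λ), and the staircase condition r < a r leaves at
-- most a i − mr(λ) such rows. Discarding the rows of the other t − 1 boxes, every placement hitting
-- t boxes yields mr(λ) − (t − 1) distinct placements hitting the last t − 1 of them.

open import Defs
open import Level using (Level)
open import Function.Base using (_∘_; flip)
open import Function.Definitions using (Injective)
open import Data.Nat using (ℕ; zero; suc; _≤_; _<_; _≥_; _∸_; _*_; _+_; _⊓_; _≡ᵇ_; z≤n; s≤s)
open import Data.Nat.Properties
open import Data.Nat.Combinatorics using (_P_)
open import Data.Nat.Combinatorics.Base using (_P′_)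
open import Data.Nat.Combinatorics.Specification using (nPk≡n!/[n∸k]!; nP′k≡n!/[n∸k]!)
open import Data.Fin using (Fin; zero; suc; toℕ; opposite) renaming (_≤_ to _≤ᶠ_; _≟_ to _≟ᶠ_)
open import Data.Fin.Properties using (all?; any?; toℕ-injective; toℕ<n; opposite-prop; injective⇒≤) renaming (suc-injective to suc-injectiveᶠ)
open import Data.Fin.Permutation.Components using (transpose; transpose-inverse)
open import Data.List using (List; []; _∷_; length; filter; map; foldr; reverse; allFin; cartesianProduct; cartesianProductWith; concatMap; _++_) renaming (lookup to lookupˡ)
open import Data.List.Properties using (length-++; length-map; length-tabulate; length-upTo; filter-++; filter-accept; filter-all; unfold-reverse)
open import Data.List.Membership.Propositional using (_∈_)
open import Data.List.Membership.Propositional.Properties using (∈-filter⁺; ∈-filter⁻; ∈-map⁺; ∈-lookup; ∈-allFin; ∈-upTo⁺; ∈-cartesianProduct⁻; ∈-cartesianProductWith⁺)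
open import Data.List.Relation.Unary.Any using (here; there; index)
open import Data.List.Relation.Unary.Any.Properties using (lookup-index; reverse⁺; reverse⁻)
open import Data.List.Relation.Unary.All as All using (All; []; _∷_)
open import Data.List.Relation.Unary.AllPairs using (AllPairs; []; _∷_)
import Data.List.Relation.Unary.AllPairs.Properties as AllPairs
open import Data.List.Relation.Unary.Unique.Propositional using (Unique)
import Data.List.Relation.Unary.Unique.Propositional.Properties as Unique
open import Data.List.Relation.Binary.Sublist.Propositional using (⊆-refl)
open import Data.List.Relation.Binary.Sublist.Propositional.Properties using (length-mono-≤) renaming (filter⁺ to sublist-filter⁺)
open import Data.Vec using (Vec; lookup; toList; tabulate) renaming ([] to []ᵥ; _∷_ to _∷ᵥ_)
open import Data.Vec.Properties using (lookup∘tabulate; tabulate∘lookup; tabulate-cong; ∷-injective)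
open import Data.Vec.Membership.Propositional.Properties using (∈-toList⁺) renaming (∈-lookup to ∈-lookupᵥ)
open import Data.Bool using (true; false; T)
open import Data.Product using (_×_; _,_; proj₁; proj₂; ∃; uncurry)
open import Data.Sum using (_⊎_; inj₁; inj₂)
open import Data.Unit using (⊤; tt)
open import Relation.Nullary using (yes; no; ¬_; contradiction)
open import Relation.Nullary.Decidable using (dec-true; dec-false; _×-dec_; _⊎-dec_)
open import Relation.Unary using (Pred; Decidable)
open import Relation.Binary.PropositionalEquality using (_≡_; _≢_; refl; sym; trans; cong; cong₂; subst; module ≡-Reasoning)

private
  variable
    a b p q r : Level
    A : Set a
    B : Set b

count : {P : Pred A p} → Decidable P → List A → ℕ
count P? xs = length (filter P? xs)

Unique⇒lookup-injective : {xs : List A} → Unique xs → Injective _≡_ _≡_ (lookupˡ xs)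
Unique⇒lookup-injective (_ ∷ _) {zero} {zero} _ = refl
Unique⇒lookup-injective (x≢ ∷ _) {zero} {suc j} e = contradiction e (All.lookup x≢ (∈-lookup j))
Unique⇒lookup-injective (x≢ ∷ _) {suc i} {zero} e = contradiction (sym e) (All.lookup x≢ (∈-lookup i))
Unique⇒lookup-injective (_ ∷ u) {suc i} {suc j} e = cong suc (Unique⇒lookup-injective u e)

length-≤-injection : {xs : List A} {ys : List B} (g : A → B) → Unique xs →
  (∀ {x} → x ∈ xs → g x ∈ ys) → (∀ {x y} → x ∈ xs → y ∈ xs → g x ≡ g y → x ≡ y) →
  length xs ≤ length ys
length-≤-injection {xs = xs} {ys} g u into inj = injective⇒≤ position-injective
  where
  position : Fin (length xs) → Fin (length ys)
  position k = index (into (∈-lookup k))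

  position-injective : Injective _≡_ _≡_ position
  position-injective {k} {k′} e = Unique⇒lookup-injective u (inj (∈-lookup k) (∈-lookup k′) (begin
    g (lookupˡ xs k)         ≡⟨ lookup-index (into (∈-lookup k)) ⟩
    lookupˡ ys (position k)  ≡⟨ cong (lookupˡ ys) e ⟩
    lookupˡ ys (position k′) ≡⟨ lookup-index (into (∈-lookup k′)) ⟨
    g (lookupˡ xs k′)        ∎))
    where open ≡-Reasoning

length-≤-injection-upTo : {xs : List A} (g : A → ℕ) {k : ℕ} → Unique xs →
  (∀ {x} → x ∈ xs → g x < k) → (∀ {x y} → x ∈ xs → y ∈ xs → g x ≡ g y → x ≡ y) →
  length xs ≤ k
length-≤-injection-upTo g {k} u below inj =
  subst (_ ≤_) (length-upTo k) (length-≤-injection g u (∈-upTo⁺ ∘ below) inj)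

module _ {P : Pred A p} (P? : Decidable P) where

  count-∷ : ∀ x xs → count P? xs ≤ count P? (x ∷ xs)
  count-∷ x xs with P? x
  ... | yes _ = n≤1+n _
  ... | no _ = ≤-refl

  count-++ : ∀ xs ys → count P? (xs ++ ys) ≡ count P? xs + count P? ys
  count-++ xs ys = trans (cong length (filter-++ P? xs ys)) (length-++ (filter P? xs))

  count-map : (g : B → A) → ∀ ys → count P? (map g ys) ≡ count (P? ∘ g) ys
  count-map g [] = refl
  count-map g (y ∷ ys) with P? (g y)
  ... | yes _ = cong suc (count-map g ys)
  ... | no _ = count-map g ys

  count-mono : {Q : Pred A q} (Q? : Decidable Q) → (∀ {x} → P x → Q x) → ∀ xs → count P? xs ≤ count Q? xs
  count-mono Q? P⇒Q xs = length-mono-≤ (sublist-filter⁺ P? Q? {as = xs} (λ { refl → P⇒Q }) ⊆-refl)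

module _ {Q : Pred A q} {R : Pred A r} (Q? : Decidable Q) (R? : Decidable R) where

  count-⊎ : {P : Pred A p} (P? : Decidable P) → (∀ {x} → P x → Q x ⊎ R x) → ∀ xs →
    count P? xs ≤ count Q? xs + count R? xs
  count-⊎ P? cover [] = z≤n
  count-⊎ P? cover (x ∷ xs) with P? x
  ... | no ¬px = ≤-trans (count-⊎ P? cover xs) (+-mono-≤ (count-∷ Q? x xs) (count-∷ R? x xs))
  ... | yes px with cover px
  ...   | inj₁ qx rewrite filter-accept Q? {xs = xs} qx =
          s≤s (≤-trans (count-⊎ P? cover xs) (+-monoʳ-≤ (count Q? xs) (count-∷ R? x xs)))
  ...   | inj₂ rx rewrite filter-accept R? {xs = xs} rx =
          ≤-trans (s≤s (≤-trans (count-⊎ P? cover xs) (+-monoˡ-≤ (count R? xs) (count-∷ Q? x xs))))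
                  (≤-reflexive (sym (+-suc (count Q? (x ∷ xs)) (count R? xs))))

  length-≤-count-⊎ : (∀ x → Q x ⊎ R x) → ∀ xs → length xs ≤ count Q? xs + count R? xs
  length-≤-count-⊎ cover xs = subst (_≤ count Q? xs + count R? xs)
    (cong length (filter-all true? (All.universal (λ _ → tt) xs)))
    (count-⊎ true? (λ {x} _ → cover x) xs)
    where
    true? : Decidable {A = A} (λ _ → ⊤)
    true? _ = yes tt

count-cartesianProduct-≥ : {P : Pred (A × B) p} (P? : Decidable P) {c : ℕ} (xs : List A) (ys : List B) →
  (∀ {x} → x ∈ xs → c ≤ count (λ y → P? (x , y)) ys) → length xs * c ≤ count P? (cartesianProduct xs ys)
count-cartesianProduct-≥ P? [] ys fibre = z≤n
count-cartesianProduct-≥ P? {c} (x ∷ xs) ys fibre = begin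
  c + length xs * c
    ≤⟨ +-mono-≤ (fibre (here refl)) (count-cartesianProduct-≥ P? xs ys (fibre ∘ there)) ⟩
  count (λ y → P? (x , y)) ys + count P? (cartesianProduct xs ys)
    ≡⟨ cong (_+ count P? (cartesianProduct xs ys)) (count-map P? (x ,_) ys) ⟨
  count P? (map (x ,_) ys) + count P? (cartesianProduct xs ys)
    ≡⟨ count-++ P? (map (x ,_) ys) (cartesianProduct xs ys) ⟨
  count P? (cartesianProduct (x ∷ xs) ys) ∎
  where open ≤-Reasoning

concatMap-map≡cartesianProductWith : {C : Set} (f : A → B → C) (xs : List A) (ys : List B) →
  concatMap (λ x → map (f x) ys) xs ≡ cartesianProductWith f xs ys
concatMap-map≡cartesianProductWith f [] ys = refl
concatMap-map≡cartesianProductWith f (x ∷ xs) ys = cong (map (f x) ys ++_) (concatMap-map≡cartesianProductWith f xs ys)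

allVecs-unique : ∀ m k → Unique (allVecs m k)
allVecs-unique m zero = [] ∷ []
allVecs-unique m (suc k) rewrite concatMap-map≡cartesianProductWith _∷ᵥ_ (allFin m) (allVecs m k) =
  Unique.cartesianProductWith⁺ _∷ᵥ_ ∷-injective (Unique.allFin⁺ m) (allVecs-unique m k)

∈-allVecs : ∀ {m k} (v : Vec (Fin m) k) → v ∈ allVecs m k
∈-allVecs []ᵥ = here refl
∈-allVecs {m} {suc k} (x ∷ᵥ v) rewrite concatMap-map≡cartesianProductWith _∷ᵥ_ (allFin m) (allVecs m k) =
  ∈-cartesianProductWith⁺ _∷ᵥ_ (∈-allFin x) (∈-allVecs v)

-- Swapping two rows of a permutation matrix

module _ {n : ℕ} where

  transpose-matchʳ : (i j : Fin n) → transpose i j j ≡ i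
  transpose-matchʳ i j with j ≟ᶠ i
  ... | yes j≡i = j≡i
  ... | no _ rewrite dec-true (j ≟ᶠ j) refl = refl

  transpose-other : {i j k : Fin n} → k ≢ i → k ≢ j → transpose i j k ≡ k
  transpose-other {i} {j} {k} k≢i k≢j rewrite dec-false (k ≟ᶠ i) k≢i | dec-false (k ≟ᶠ j) k≢j = refl

  transpose-elim : (Q : Fin n → Fin n → Set a) {i j : Fin n} → Q i j → Q j i →
    (∀ {k} → k ≢ i → k ≢ j → Q k k) → ∀ k → Q k (transpose i j k)
  transpose-elim Q {i} {j} qi qj qk k with k ≟ᶠ i
  ... | yes refl = qi
  ... | no k≢i with k ≟ᶠ j
  ...   | yes refl = qj
  ...   | no k≢j = qk k≢i k≢j

  swapRows : Vec A n → Fin n → Fin n → Vec A n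
  swapRows σ i j = tabulate (lookup σ ∘ transpose i j)

  lookup-swapRows : (σ : Vec A n) (i j k : Fin n) → lookup (swapRows σ i j) k ≡ lookup σ (transpose i j k)
  lookup-swapRows σ i j = lookup∘tabulate (lookup σ ∘ transpose i j)

  swapRows-swapRows : (σ : Vec A n) (i j : Fin n) → swapRows (swapRows σ i j) j i ≡ σ
  swapRows-swapRows σ i j = trans (tabulate-cong λ k → trans (lookup-swapRows σ i j (transpose j i k))
                                                            (cong (lookup σ) (transpose-inverse i j)))
                                  (tabulate∘lookup σ)

  swapRows-IsPerm : (σ : Vec (Fin n) n) (i j : Fin n) → IsPerm σ → IsPerm (swapRows σ i j)
  swapRows-IsPerm σ i j σ-perm k k′ e = begin
    k                               ≡⟨ transpose-inverse j i ⟨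
    transpose j i (transpose i j k)  ≡⟨ cong (transpose j i) (σ-perm _ _ (begin
      lookup σ (transpose i j k)        ≡⟨ lookup-swapRows σ i j k ⟨
      lookup (swapRows σ i j) k         ≡⟨ e ⟩
      lookup (swapRows σ i j) k′        ≡⟨ lookup-swapRows σ i j k′ ⟩
      lookup σ (transpose i j k′)       ∎)) ⟩
    transpose j i (transpose i j k′) ≡⟨ transpose-inverse j i ⟩
    k′                              ∎
    where open ≡-Reasoning

  -- The swapped row r is where the value σ i reappears, so the pair (σ , r) is recovered from the image.
  swapRows-injective : {σ σ′ : Vec (Fin n) n} {i r r′ : Fin n} → IsPerm σ → lookup σ i ≡ lookup σ′ i →
    swapRows σ i r ≡ swapRows σ′ i r′ → σ ≡ σ′ × r ≡ r′
  swapRows-injective {σ} {σ′} {i} {r} {r′} σ-perm σi≡σ′i e = σ≡σ′ , r≡r′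
    where
    open ≡-Reasoning
    r≡r′ : r ≡ r′
    r≡r′ = swapRows-IsPerm σ i r σ-perm r r′ (begin
      lookup (swapRows σ i r) r    ≡⟨ lookup-swapRows σ i r r ⟩
      lookup σ (transpose i r r)   ≡⟨ cong (lookup σ) (transpose-matchʳ i r) ⟩
      lookup σ i                   ≡⟨ σi≡σ′i ⟩
      lookup σ′ i                  ≡⟨ cong (lookup σ′) (transpose-matchʳ i r′) ⟨
      lookup σ′ (transpose i r′ r′) ≡⟨ lookup-swapRows σ′ i r′ r′ ⟨
      lookup (swapRows σ′ i r′) r′ ≡⟨ cong (λ τ → lookup τ r′) e ⟨
      lookup (swapRows σ i r) r′   ∎)
    σ≡σ′ : σ ≡ σ′
    σ≡σ′ = begin
      σ                                ≡⟨ swapRows-swapRows σ i r ⟨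
      swapRows (swapRows σ i r) r i    ≡⟨ cong (λ τ → swapRows τ r i) e ⟩
      swapRows (swapRows σ′ i r′) r i  ≡⟨ cong (λ s → swapRows (swapRows σ′ i r′) s i) r≡r′ ⟩
      swapRows (swapRows σ′ i r′) r′ i ≡⟨ swapRows-swapRows σ′ i r′ ⟩
      σ′                               ∎

-- Rook placements on the board of λ

n≤[n∸m]+o⇒m≤o : ∀ {m n o} → m ≤ n → n ≤ (n ∸ m) + o → m ≤ o
n≤[n∸m]+o⇒m≤o {m} {n} {o} m≤n le = subst (_≤ o) (m∸[m∸n]≡n m≤n) (m≤n+o⇒m∸n≤o n (n ∸ m) le)

module _ {n : ℕ} (lam : Vec ℕ n) where

  rowBound : Fin n → ℕ
  rowBound r = lookup lam (opposite r)

  Swappable : Vec (Fin n) n → Fin n → Fin n → Set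
  Swappable σ i j = toℕ (lookup σ j) < rowBound i × toℕ (lookup σ i) < rowBound j

  swappable? : (σ : Vec (Fin n) n) (i : Fin n) → Decidable (Swappable σ i)
  swappable? σ i j = (toℕ (lookup σ j) <? rowBound i) ×-dec (toℕ (lookup σ i) <? rowBound j)

  swapRows-InRP : {σ : Vec (Fin n) n} {i j : Fin n} → InRP lam σ → Swappable σ i j → InRP lam (swapRows σ i j)
  swapRows-InRP {σ} {i} {j} (σ-perm , σ-inside) (σj<i , σi<j) = swapRows-IsPerm σ i j σ-perm , λ k →
    subst (λ v → toℕ v < rowBound k) (sym (lookup-swapRows σ i j k))
      (transpose-elim (λ k k′ → toℕ (lookup σ k′) < rowBound k) σj<i σi<j (λ {k} _ _ → σ-inside k) k)

  RPHits : ∀ {t} → (Fin t → Fin n × Fin n) → Vec (Fin n) n → Set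
  RPHits b σ = InRP lam σ × (∀ k → Hits σ (b k))

  rpHits? : ∀ {t} (b : Fin t → Fin n × Fin n) → Decidable (RPHits b)
  rpHits? b σ = inRP? lam σ ×-dec all? (λ k → hits? σ (b k))

module _ {n : ℕ} (lam : Vec ℕ n) (M : ℕ)
  (staircase : ∀ r → toℕ r < rowBound lam r)
  (rowBound≤n : ∀ r → rowBound lam r ≤ n)
  (M≤rowBound : ∀ r → M ≤ rowBound lam r)
  (rowBound-gap : ∀ r r′ → rowBound lam r′ < rowBound lam r → rowBound lam r′ + M ≤ rowBound lam r)
  where

  swappableRows-≥ : {σ : Vec (Fin n) n} → InRP lam σ → (i : Fin n) → M ≤ count (swappable? lam σ i) (allFin n)
  swappableRows-≥ {σ} (σ-perm , σ-inside) i =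
    n≤[n∸m]+o⇒m≤o (M≤rowBound i) (n≤[n∸m]+o⇒m≤o (rowBound≤n i) (begin
      n
        ≡⟨ length-tabulate (λ r → r) ⟨
      length (allFin n)
        ≤⟨ length-≤-count-⊎ high? low-or-swappable? cover (allFin n) ⟩
      count high? (allFin n) + count low-or-swappable? (allFin n)
        ≤⟨ +-mono-≤ high-bound (count-⊎ low? (swappable? lam σ i) low-or-swappable? (λ x → x) (allFin n)) ⟩
      (n ∸ boundᵢ) + (count low? (allFin n) + count (swappable? lam σ i) (allFin n))
        ≤⟨ +-monoʳ-≤ (n ∸ boundᵢ) (+-monoˡ-≤ (count (swappable? lam σ i) (allFin n)) low-bound) ⟩
      (n ∸ boundᵢ) + ((boundᵢ ∸ M) + count (swappable? lam σ i) (allFin n)) ∎))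
    where
    open ≤-Reasoning
    boundᵢ : ℕ
    boundᵢ = rowBound lam i

    High : Pred (Fin n) _
    High r = boundᵢ ≤ toℕ (lookup σ r)
    high? : Decidable High
    high? r = boundᵢ ≤? toℕ (lookup σ r)

    Low : Pred (Fin n) _
    Low r = rowBound lam r ≤ toℕ (lookup σ i)
    low? : Decidable Low
    low? r = rowBound lam r ≤? toℕ (lookup σ i)

    low-or-swappable? : Decidable (λ r → Low r ⊎ Swappable lam σ i r)
    low-or-swappable? r = low? r ⊎-dec swappable? lam σ i r

    cover : ∀ r → High r ⊎ (Low r ⊎ Swappable lam σ i r)
    cover r with toℕ (lookup σ r) <? boundᵢ | toℕ (lookup σ i) <? rowBound lam r
    ... | no σr≮boundᵢ | _ = inj₁ (≮⇒≥ σr≮boundᵢ)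
    ... | yes _ | no σi≮r = inj₂ (inj₁ (≮⇒≥ σi≮r))
    ... | yes σr<boundᵢ | yes σi<r = inj₂ (inj₂ (σr<boundᵢ , σi<r))

    high-bound : count high? (allFin n) ≤ n ∸ boundᵢ
    high-bound = length-≤-injection-upTo (λ r → toℕ (lookup σ r) ∸ boundᵢ)
      (Unique.filter⁺ high? (Unique.allFin⁺ n))
      (λ {r} r∈ → ∸-monoˡ-< (toℕ<n (lookup σ r)) (high⁻ r∈))
      (λ r∈ r′∈ e → σ-perm _ _ (toℕ-injective (∸-cancelʳ-≡ (high⁻ r∈) (high⁻ r′∈) e)))
      where
      high⁻ : ∀ {r} → r ∈ filter high? (allFin n) → High r
      high⁻ r∈ = proj₂ (∈-filter⁻ high? {xs = allFin n} r∈)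

    low-bound : count low? (allFin n) ≤ boundᵢ ∸ M
    low-bound = length-≤-injection-upTo toℕ (Unique.filter⁺ low? (Unique.allFin⁺ n))
      (λ {r} r∈ → <-≤-trans (staircase r)
        (m+n≤o⇒m≤o∸n (rowBound lam r) (rowBound-gap i r (≤-<-trans (low⁻ r∈) (σ-inside i)))))
      (λ _ _ → toℕ-injective)
      where
      low⁻ : ∀ {r} → r ∈ filter low? (allFin n) → Low r
      low⁻ r∈ = proj₂ (∈-filter⁻ low? {xs = allFin n} r∈)

  module Extension {t : ℕ} (b : Fin (suc t) → Fin n × Fin n) (b-injective : Injective _≡_ _≡_ b) where

    i : Fin n
    i = proj₁ (b zero)

    RowOfRest : Pred (Fin n) _
    RowOfRest r = ∃ λ k → proj₁ (b (suc k)) ≡ r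

    rowOfRest? : Decidable RowOfRest
    rowOfRest? r = any? (λ k → proj₁ (b (suc k)) ≟ᶠ r)

    Extends : Pred (Vec (Fin n) n × Fin n) _
    Extends (σ , r) = RPHits lam (b ∘ suc) (swapRows σ i r)

    extends? : Decidable Extends
    extends? (σ , r) = rpHits? lam (b ∘ suc) (swapRows σ i r)

    swap-extends : {σ : Vec (Fin n) n} {r : Fin n} → RPHits lam b σ → Swappable lam σ i r → ¬ RowOfRest r →
      Extends (σ , r)
    swap-extends {σ} {r} (σ-inside , σ-hits) swappable ¬rest = swapRows-InRP lam {σ} {i} {r} σ-inside swappable , hits
      where
      hits : ∀ k → Hits (swapRows σ i r) (b (suc k))
      hits k = trans (lookup-swapRows σ i r rₖ) (trans (cong (lookup σ) (transpose-other rₖ≢i rₖ≢r)) (σ-hits (suc k)))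
        where
        rₖ : Fin n
        rₖ = proj₁ (b (suc k))
        rₖ≢r : rₖ ≢ r
        rₖ≢r e = ¬rest (k , e)
        rₖ≢i : rₖ ≢ i
        rₖ≢i e with b-injective (cong₂ _,_ e (trans (sym (σ-hits (suc k))) (trans (cong (lookup σ) e) (σ-hits zero))))
        ... | ()

    rowsOfRest-≤ : count rowOfRest? (allFin n) ≤ t
    rowsOfRest-≤ = subst (count rowOfRest? (allFin n) ≤_) (trans (length-map rows (allFin t)) (length-tabulate (λ k → k)))
      (length-≤-injection (λ r → r) (Unique.filter⁺ rowOfRest? (Unique.allFin⁺ n)) into (λ _ _ e → e))
      where
      rows : Fin t → Fin n
      rows k = proj₁ (b (suc k))
      into : ∀ {r} → r ∈ filter rowOfRest? (allFin n) → r ∈ map rows (allFin t)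
      into r∈ with proj₂ (∈-filter⁻ rowOfRest? {xs = allFin n} r∈)
      ... | k , refl = ∈-map⁺ rows (∈-allFin k)

    extensions-≥ : {σ : Vec (Fin n) n} → RPHits lam b σ → M ∸ t ≤ count (λ r → extends? (σ , r)) (allFin n)
    extensions-≥ {σ} σ-hits = m≤n+o⇒m∸n≤o M t (begin
      M
        ≤⟨ swappableRows-≥ {σ} (proj₁ σ-hits) i ⟩
      count (swappable? lam σ i) (allFin n)
        ≤⟨ count-⊎ extends?ʳ rowOfRest? (swappable? lam σ i) cover (allFin n) ⟩
      count extends?ʳ (allFin n) + count rowOfRest? (allFin n)
        ≤⟨ +-monoʳ-≤ (count extends?ʳ (allFin n)) rowsOfRest-≤ ⟩
      count extends?ʳ (allFin n) + t
        ≡⟨ +-comm _ t ⟩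
      t + count extends?ʳ (allFin n) ∎)
      where
      open ≤-Reasoning
      extends?ʳ : Decidable (λ r → Extends (σ , r))
      extends?ʳ r = extends? (σ , r)
      cover : ∀ {r} → Swappable lam σ i r → Extends (σ , r) ⊎ RowOfRest r
      cover {r} swappable with rowOfRest? r
      ... | yes rest = inj₂ rest
      ... | no ¬rest = inj₁ (swap-extends {σ} {r} σ-hits swappable ¬rest)

    countHits-step : countHits lam b * (M ∸ t) ≤ countHits lam (b ∘ suc)
    countHits-step = begin
      countHits lam b * (M ∸ t)
        ≤⟨ count-cartesianProduct-≥ extends? hitting (allFin n) (λ {σ} σ∈ → extensions-≥ {σ} (hitting⁻ σ∈)) ⟩
      count extends? (cartesianProduct hitting (allFin n))
        ≤⟨ length-≤-injection (λ (σ , r) → swapRows σ i r) unique into injective ⟩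
      countHits lam (b ∘ suc) ∎
      where
      open ≤-Reasoning
      hitting : List (Vec (Fin n) n)
      hitting = filter (rpHits? lam b) (allVecs n n)
      hitting⁻ : ∀ {σ} → σ ∈ hitting → RPHits lam b σ
      hitting⁻ σ∈ = proj₂ (∈-filter⁻ (rpHits? lam b) {xs = allVecs n n} σ∈)
      pairs : List (Vec (Fin n) n × Fin n)
      pairs = filter extends? (cartesianProduct hitting (allFin n))
      pairs⁻ : ∀ {σ r} → (σ , r) ∈ pairs → RPHits lam b σ × Extends (σ , r)
      pairs⁻ p∈ with ∈-filter⁻ extends? {xs = cartesianProduct hitting (allFin n)} p∈
      ... | p∈′ , ext = hitting⁻ (proj₁ (∈-cartesianProduct⁻ hitting (allFin n) p∈′)) , ext
      unique : Unique pairs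
      unique = Unique.filter⁺ extends? (Unique.cartesianProduct⁺ (Unique.filter⁺ (rpHits? lam b) (allVecs-unique n n))
                                                                 (Unique.allFin⁺ n))
      into : ∀ {p} → p ∈ pairs → swapRows (proj₁ p) i (proj₂ p) ∈ filter (rpHits? lam (b ∘ suc)) (allVecs n n)
      into p∈ = ∈-filter⁺ (rpHits? lam (b ∘ suc)) (∈-allVecs _) (proj₂ (pairs⁻ p∈))
      injective : ∀ {p p′} → p ∈ pairs → p′ ∈ pairs →
        swapRows (proj₁ p) i (proj₂ p) ≡ swapRows (proj₁ p′) i (proj₂ p′) → p ≡ p′
      injective {σ , r} {σ′ , r′} p∈ p′∈ e with pairs⁻ p∈ | pairs⁻ p′∈
      ... | ((σ-perm , _) , σ-hits) , _ | (_ , σ′-hits) , _ =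
        uncurry (cong₂ _,_) (swapRows-injective σ-perm (trans (σ-hits zero) (sym (σ′-hits zero))) e)

  countHits*P′≤countRP : ∀ t (b : Fin t → Fin n × Fin n) → Injective _≡_ _≡_ b →
    countHits lam b * (M P′ t) ≤ countRP lam
  countHits*P′≤countRP zero b _ = begin
    countHits lam b * 1 ≡⟨ *-identityʳ _ ⟩
    countHits lam b     ≤⟨ count-mono (rpHits? lam b) (inRP? lam) proj₁ (allVecs n n) ⟩
    countRP lam         ∎
    where open ≤-Reasoning
  countHits*P′≤countRP (suc t) b b-injective = begin
    countHits lam b * ((M ∸ t) * (M P′ t))
      ≡⟨ *-assoc (countHits lam b) (M ∸ t) (M P′ t) ⟨
    countHits lam b * (M ∸ t) * (M P′ t)
      ≤⟨ *-monoˡ-≤ (M P′ t) (Extension.countHits-step b b-injective) ⟩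
    countHits lam (b ∘ suc) * (M P′ t)
      ≤⟨ countHits*P′≤countRP t (b ∘ suc) (suc-injectiveᶠ ∘ b-injective) ⟩
    countRP lam ∎
    where open ≤-Reasoning

-- The minimum run

values : List (ℕ × ℕ) → List ℕ
values = map proj₁

∈-groupRuns⁺ : ∀ xs {x} → x ∈ xs → x ∈ values (groupRuns xs)
∈-groupRuns⁺ (y ∷ ys) x∈ with groupRuns ys | ∈-groupRuns⁺ ys
... | [] | ih with x∈
...   | here x≡y = here x≡y
...   | there x∈ys with () ← ih x∈ys
∈-groupRuns⁺ (y ∷ ys) x∈ | (z , _) ∷ _ | ih with y ≡ᵇ z in y≡ᵇz
... | true with x∈
...   | here x≡y = here (trans x≡y (≡ᵇ⇒≡ y z (subst T (sym y≡ᵇz) tt)))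
...   | there x∈ys = ih x∈ys
∈-groupRuns⁺ (y ∷ ys) x∈ | (z , _) ∷ _ | ih | false with x∈
...   | here x≡y = here x≡y
...   | there x∈ys = there (ih x∈ys)

∈-groupRuns⁻ : ∀ xs {v} → v ∈ values (groupRuns xs) → v ∈ xs
∈-groupRuns⁻ (y ∷ ys) v∈ with groupRuns ys | ∈-groupRuns⁻ ys
... | [] | _ with v∈
...   | here v≡y = here v≡y
∈-groupRuns⁻ (y ∷ ys) v∈ | (z , _) ∷ _ | ih with y ≡ᵇ z
... | true = there (ih v∈)
... | false with v∈
...   | here v≡y = here v≡y
...   | there v∈′ = there (ih v∈′)

groupRuns-strictlySorted : ∀ xs → AllPairs _≤_ xs → AllPairs _<_ (values (groupRuns xs))
groupRuns-strictlySorted [] _ = []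
groupRuns-strictlySorted (y ∷ ys) (y≤ys ∷ ys-sorted)
  with groupRuns ys | groupRuns-strictlySorted ys ys-sorted | ∈-groupRuns⁻ ys
... | [] | _ | _ = [] ∷ []
... | (z , _) ∷ _ | ih | values⊆ys with y ≡ᵇ z in y≡ᵇz
...   | true = ih
...   | false with ih
...     | z< ∷ rest-sorted = (y<z ∷ All.map (<-trans y<z) z<) ∷ z< ∷ rest-sorted
  where
  y<z : y < z
  y<z = ≤∧≢⇒< (All.lookup y≤ys (values⊆ys (here refl))) (λ y≡z → subst T y≡ᵇz (≡⇒≡ᵇ y z y≡z))

minList-≤ : ∀ xs → All (minList xs ≤_) xs
minList-≤ [] = []
minList-≤ (x ∷ xs) = proj₁ (foldr-⊓ xs) ∷ proj₂ (foldr-⊓ xs)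
  where
  foldr-⊓ : ∀ ys → foldr _⊓_ x ys ≤ x × All (foldr _⊓_ x ys ≤_) ys
  foldr-⊓ [] = ≤-refl , []
  foldr-⊓ (y ∷ ys) = ≤-trans (m⊓n≤n y _) (proj₁ (foldr-⊓ ys))
                   , m⊓n≤m y _ ∷ All.map (≤-trans (m⊓n≤n y _)) (proj₂ (foldr-⊓ ys))

-- Any two listed values differ by a sum of consecutive increments v_ℓ ∸ v_{ℓ-1}, each at least M.
runLengths-gap : ∀ {M} prev gs → All (M ≤_) (runLengths prev gs) → AllPairs _<_ (values gs) →
  All (prev ≤_) (values gs) → ∀ {x y} → x ∈ prev ∷ values gs → y ∈ values gs → x < y → M ≤ y ∸ x
runLengths-gap {M} prev ((v , _) ∷ gs) (M≤v∸prev ∷ _ ∷ M≤rest) (v< ∷ gs-sorted) (prev≤v ∷ _) = gap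
  where
  ih : ∀ {x y} → x ∈ v ∷ values gs → y ∈ values gs → x < y → M ≤ y ∸ x
  ih = runLengths-gap v gs M≤rest gs-sorted (All.map <⇒≤ v<)
  gap : ∀ {x y} → x ∈ prev ∷ v ∷ values gs → y ∈ v ∷ values gs → x < y → M ≤ y ∸ x
  gap (here refl) (here refl) _ = M≤v∸prev
  gap {y = y} (here refl) (there y∈) _ = ≤-trans (ih (here refl) y∈ (All.lookup v< y∈)) (∸-monoʳ-≤ y prev≤v)
  gap (there (here refl)) (here refl) v<v = contradiction v<v (<-irrefl refl)
  gap (there (there x∈)) (here refl) x<v = contradiction x<v (<-asym (All.lookup v< x∈))
  gap (there x∈) (there y∈) x<y = ih x∈ y∈ x<y

AllPairs-reverse⁺ : {R : A → A → Set r} {xs : List A} → AllPairs R xs → AllPairs (flip R) (reverse xs)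
AllPairs-reverse⁺ [] = []
AllPairs-reverse⁺ {R = R} {x ∷ xs} (x-R ∷ xs-R) = subst (AllPairs (flip R)) (sym (unfold-reverse x xs))
  (AllPairs.++⁺ (AllPairs-reverse⁺ xs-R) ([] ∷ []) (All.tabulate (λ y∈ → All.lookup x-R (reverse⁻ y∈) ∷ [])))

All-toList⁺ : ∀ {k} {Q : Pred A q} (v : Vec A k) → (∀ i → Q (lookup v i)) → All Q (toList v)
All-toList⁺ []ᵥ _ = []
All-toList⁺ (x ∷ᵥ v) Q-v = Q-v zero ∷ All-toList⁺ v (Q-v ∘ suc)

toList-antitone : ∀ {k} (v : Vec ℕ k) → (∀ i j → i ≤ᶠ j → lookup v j ≤ lookup v i) → AllPairs _≥_ (toList v)
toList-antitone []ᵥ _ = []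
toList-antitone (x ∷ᵥ v) antitone =
  All-toList⁺ v (λ k → antitone zero (suc k) z≤n)
  ∷ toList-antitone v (λ i j i≤j → antitone (suc i) (suc j) (s≤s i≤j))

mr-gap : ∀ {k} (lam : Vec ℕ k) → (∀ i j → i ≤ᶠ j → lookup lam j ≤ lookup lam i) →
  ∀ {x y} → x ∈ 0 ∷ toList lam → y ∈ toList lam → x < y → mr lam ≤ y ∸ x
mr-gap lam antitone x∈ y∈ = runLengths-gap 0 (groupRuns parts) (minList-≤ _)
  (groupRuns-strictlySorted parts (AllPairs-reverse⁺ (toList-antitone lam antitone)))
  (All.universal (λ _ → z≤n) _) (lift x∈) (∈-groupRuns⁺ parts (reverse⁺ y∈))
  where
  parts : List ℕ
  parts = reverse (toList lam)
  lift : ∀ {x} → x ∈ 0 ∷ toList lam → x ∈ 0 ∷ values (groupRuns parts)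
  lift (here refl) = here refl
  lift (there x∈) = there (∈-groupRuns⁺ parts (reverse⁺ x∈))

proposition5p4 : (m : ℕ) → (lam : Vec ℕ (suc m)) →
    ((i j : Fin (suc m)) → i ≤ᶠ j → lookup lam j ≤ lookup lam i) →
    lookup lam zero ≡ suc m →
    ((i : Fin (suc m)) → suc m ∸ toℕ i ≤ lookup lam i) →
    (t : ℕ) → 1 ≤ t → t ≤ mr lam →
    (b : Fin t → Fin (suc m) × Fin (suc m)) → Injective _≡_ _≡_ b →
    countHits lam b * (mr lam P t) ≤ countRP lam
proposition5p4 m lam antitone λ₁≡n λᵢ≥n+1-i t _ t≤mr b b-injective = begin
  countHits lam b * (mr lam P t)
    ≡⟨ cong (countHits lam b *_) (trans (nPk≡n!/[n∸k]! t≤mr) (sym (nP′k≡n!/[n∸k]! t≤mr))) ⟩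
  countHits lam b * (mr lam P′ t)
    ≤⟨ countHits*P′≤countRP lam (mr lam) staircase rowBound≤n mr≤rowBound rowBound-gap t b b-injective ⟩
  countRP lam ∎
  where
  open ≤-Reasoning

  staircase : ∀ r → toℕ r < rowBound lam r
  staircase r = subst (_≤ rowBound lam r) (trans (cong (suc m ∸_) (opposite-prop r)) (m∸[m∸n]≡n (toℕ<n r)))
                      (λᵢ≥n+1-i (opposite r))

  rowBound≤n : ∀ r → rowBound lam r ≤ suc m
  rowBound≤n r = subst (rowBound lam r ≤_) λ₁≡n (antitone zero (opposite r) z≤n)

  rowBound∈ : ∀ r → rowBound lam r ∈ toList lam
  rowBound∈ r = ∈-toList⁺ (∈-lookupᵥ (opposite r) lam)

  mr≤rowBound : ∀ r → mr lam ≤ rowBound lam r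
  mr≤rowBound r = mr-gap lam antitone (here refl) (rowBound∈ r) (≤-<-trans z≤n (staircase r))

  rowBound-gap : ∀ r r′ → rowBound lam r′ < rowBound lam r → rowBound lam r′ + mr lam ≤ rowBound lam r
  rowBound-gap r r′ lt = subst (_≤ rowBound lam r) (+-comm (mr lam) (rowBound lam r′))
    (m≤o∸n⇒m+n≤o (mr lam) (<⇒≤ lt) (mr-gap lam antitone (there (rowBound∈ r′)) (rowBound∈ r) lt))
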